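{- Let $\mathcal L$ be an SG-LCS with induced game $\mathcal G$, let $x\in\{0,1\}$, and let $T$ be a regular set of configurations. Then $\mathrm{Force}^x(\mathcal G,T)$ is a regular set of configurations, and a finite representation of it (by finite automata) is computable from $\mathcal L$ and a finite representation of $T$.
   Context: An SG-LCS is a tuple $\mathcal L=(\mathtt S,\mathtt S^0,\mathtt S^1,\mathtt C,\mathtt M,\mathtt T,\lambda,\mathrm{Col})$: finite set $\mathtt S$ of control states partitioned into $\mathtt S^0,\mathtt S^1$; finite set $\mathtt C$ of channels; finite alphabet $\mathtt M$; finite set $\mathtt T$ of transitions $\mathtt s\xrightarrow{op}\mathtt s'$ with $op\in\{c!m,c?m,\mathrm{nop}\}$; loss rate $0<\lambda<1$; coloring $\mathrm{Col}:\mathtt S\to\{0,\dots,n\}$. The induced game $\mathcal G=(S,S^0,S^1,S^R,\to,P,\mathrm{Col})$: $S=\mathtt S\times(\mathtt M^*)^{\mathtt C}\times\{0,1\}$, $S^R=\mathtt S\times(\mathtt M^*)^{\mathtt C}\times\{0\}$, $S^y=\mathtt S^y\times(\mathtt M^*)^{\mathtt C}\times\{1\}$. $(\mathtt s,\mathbf x,1)\to(\mathtt s',\mathbf x',0)$ iff some $\mathtt s\xrightarrow{op}\mathtt s'\in\mathtt T$ has: $op=\mathrm{nop}$, $\mathbf x'=\mathbf x$; or $op=c!m$, $\mathbf x'=\mathbf x[c\mapsto\mathbf x(c)m]$; or $op=c?m$, $\mathbf x(c)=mw$, $\mathbf x'=\mathbf x[c\mapsto w]$; if none applies, $(\mathtt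 s,\mathbf x,1)\to(\mathtt s,\mathbf x,0)$. For $\mathbf x'\preceq\mathbf x$ (componentwise subword order), $(\mathtt s,\mathbf x,0)\to(\mathtt s,\mathbf x',1)$ with probability $a\lambda^{b-c}(1-\lambda)^c$ ($a$ = number of ways to obtain $\mathbf x'$ by deleting messages from $\mathbf x$, $b,c$ = total numbers of messages in $\mathbf x,\mathbf x'$). $\mathrm{Col}(\mathtt s,\mathbf x,i)=\mathrm{Col}(\mathtt s)$. A set of channel contents is regular if it is a finite union of sets $\prod_{c\in\mathtt C}L_c$ with each $L_c\subseteq\mathtt M^*$ regular; a set $Q$ of configurations is regular if for each $\mathtt s\in\mathtt S$, $i\in\{0,1\}$, the set $\{\mathbf x:(\mathtt s,\mathbf x,i)\in Q\}$ is regular. Let $\mathrm{Pre}(Q)=\{s:\exists s'\in Q,\ s\to s'\}$, $\widetilde{\mathrm{Pre}}(Q)=S\setminus\mathrm{Pre}(S\setminus Q)$; $R_0=T$, $R_{\alpha+1}=R_\alpha\cup(S^R\cap\mathrm{Pre}(R_\alpha))\cup(S^x\cap\mathrm{Pre}(R_\alpha))\cup(S^{1-x}\cap\widetilde{\mathrm{Pre}}(R_\alpha))$, $R_\lambda=\bigcup_{\alpha<\lambda}R_\alpha$ for limit $\lambda$; $\mathrm{Force}^x(\mathcal G,T)=R_\gamma$ for the least $\gamma$ with $R_\gamma=R_{\gamma+1}$.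
   Formalization: The loss rate λ of the SG-LCS is a rational number with $0<\lambda<1$. -}

module Defs where

open import Data.Nat using (ℕ; zero; suc)
open import Data.Fin using (Fin; zero; suc)
open import Data.Bool using (Bool; true; false)
open import Data.List using (List; []; _∷_; _++_)
open import Data.List.Membership.Propositional using (_∈_)
open import Data.List.Relation.Binary.Sublist.Propositional using (_⊆_)
open import Data.List.Relation.Unary.Any using (Any)
open import Data.Vec using (Vec; lookup; _[_]≔_)
open import Data.Product using (Σ; _×_; _,_; ∃)
open import Data.Rational using (ℚ; 0ℚ; 1ℚ; _<_)
open import Relation.Binary.PropositionalEquality using (_≡_; _≢_)
open import Relation.Nullary using (¬_)

data Op (nC nM : ℕ) : Set where
  send : Fin nC → Fin nM → Op nC nM
  recv : Fin nC → Fin nM → Op nC nM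
  nop  : Op nC nM

-- SG-LCS  (states Fin nS, channels Fin nC, alphabet Fin nM,
-- owner s ≡ y  means  s ∈ S^y)

record SGLCS : Set where
  field
    nS nC nM : ℕ
    owner    : Fin nS → Fin 2
    trans    : List (Fin nS × Op nC nM × Fin nS)
    loss     : ℚ
    loss>0   : 0ℚ < loss
    loss<1   : loss < 1ℚ
    Col      : Fin nS → ℕ

module _ (L : SGLCS) where
  open SGLCS L

  Contents : Set
  Contents = Vec (List (Fin nM)) nC

  Config : Set
  Config = Fin nS × Contents × Fin 2

  data Enabled (x : Contents) : Op nC nM → Set where
    en-nop  : Enabled x nop
    en-send : ∀ c m → Enabled x (send c m)
    en-recv : ∀ c m w → lookup x c ≡ m ∷ w → Enabled x (recv c m)

  NoneApplies : Fin nS → Contents → Set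
  NoneApplies s x = ∀ {op s'} → (s , op , s') ∈ trans → ¬ Enabled x op

  -- the transition relation → of the induced game G.
  -- Random moves (s,x,0) → (s,x',1) exist exactly for x' ⪯ x, since
  -- each has probability a λ^(b-c) (1-λ)^c > 0 (a ≥ 1, 0 < λ < 1).
  data Step : Config → Config → Set where
    step-nop  : ∀ {s s' x} → (s , nop , s') ∈ trans →
                Step (s , x , suc zero) (s' , x , zero)
    step-send : ∀ {s s' x c m} → (s , send c m , s') ∈ trans →
                Step (s , x , suc zero) (s' , x [ c ]≔ (lookup x c ++ m ∷ []) , zero)
    step-recv : ∀ {s s' x c m w} → (s , recv c m , s') ∈ trans →
                lookup x c ≡ m ∷ w →
                Step (s , x , suc zero) (s' , x [ c ]≔ w , zero)
    step-stuck : ∀ {s x} → NoneApplies s x →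
                Step (s , x , suc zero) (s , x , zero)
    step-lose : ∀ {s x x'} → (∀ c → lookup x' c ⊆ lookup x c) →
                Step (s , x , zero) (s , x' , suc zero)

  -- Force^p(G,T): the least set containing T and closed under
  --   S^R ∩ Pre, S^p ∩ Pre, S^{1-p} ∩ ~Pre
  -- (= the union of the transfinite iteration R_α).
  data Force (p : Fin 2) (T : Config → Set) : Config → Set where
    base   : ∀ {c} → T c → Force p T c
    random : ∀ {s x c'} → Step (s , x , zero) c' → Force p T c' →
             Force p T (s , x , zero)
    mine   : ∀ {s x c'} → owner s ≡ p → Step (s , x , suc zero) c' →
             Force p T c' → Force p T (s , x , suc zero)
    theirs : ∀ {s x} → owner s ≢ p →
             (∀ c' → Step (s , x , suc zero) c' → Force p T c') →
             Force p T (s , x , suc zero)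

record DFA (m : ℕ) : Set where
  field
    nQ    : ℕ
    start : Fin nQ
    δ     : Fin nQ → Fin m → Fin nQ
    acc   : Fin nQ → Bool

run : ∀ {m} (A : DFA m) → Fin (DFA.nQ A) → List (Fin m) → Fin (DFA.nQ A)
run A q []       = q
run A q (a ∷ w)  = run A (DFA.δ A q a) w

Accepts : ∀ {m} → DFA m → List (Fin m) → Set
Accepts A w = DFA.acc A (run A (DFA.start A) w) ≡ true

-- a regular set of channel contents: finite union of products ∏_c L_c
RegContents : ℕ → ℕ → Set
RegContents nC nM = List (Vec (DFA nM) nC)

⟦_⟧C : ∀ {nC nM} → RegContents nC nM → Vec (List (Fin nM)) nC → Set
⟦ R ⟧C x = Any (λ v → ∀ c → Accepts (lookup v c) (lookup x c)) R

RegConfig : SGLCS → Set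
RegConfig L = Fin (SGLCS.nS L) → Fin 2 → RegContents (SGLCS.nC L) (SGLCS.nM L)

⟦_⟧ : ∀ {L} → RegConfig L → Config L → Set
⟦ R ⟧ (s , x , i) = ⟦ R s i ⟧C x

module Submission where

-- A random configuration
-- (s,x,0) moves by message losses exactly to the (s,x',1) with x' ⪯ x
-- (componentwise subwords), so outside T the random part of Force^x(G,T) is
-- the upward closure ↑B of a set B of forced player configurations.  For a
-- finite basis B we build automata for a candidate: random part T ∪ ↑B, and
-- player part T ∪ the one-move pre-image of that random part (some move for
-- player x, every move for the opponent).  Decidable emptiness either yields
-- a player configuration of the candidate outside ↑B -- it is forced and is
-- added to B -- or shows B saturated; then the candidate contains Force by
-- induction on its derivation, and is contained in Force by construction.
-- A new basis element is never above an earlier one, so by Higman's lemma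
-- the saturation terminates.

open import Defs
open import Data.Fin using (Fin)
open import Data.Product using (Σ; _,_)
open import Function.Bundles using (_⇔_)
open import Data.Nat using (ℕ)


-- Higman's lemma: every infinite sequence of words over a finite alphabet
-- contains a word that is a subword of a later one.  Constructively this is
-- the statement `Bar []` of Coquand and Fridlender: however a sequence is
-- extended word by word, it eventually becomes `Good`.
module Higman {k : ℕ} where
  open import Data.Fin using (zero; suc; _≟_)
  open import Data.List using (List; []; _∷_)
  open import Data.List.Relation.Binary.Sublist.Propositional using (_⊆_; _∷_; _∷ʳ_; minimum)
  open import Data.Vec using (Vec; []; _∷_; lookup; replicate; _[_]≔_)
  open import Data.Vec.Properties using (lookup∘update; lookup∘update′; lookup-replicate)
  open import Data.Maybe using (Maybe; just; nothing)
  open import Data.Unit using (⊤; tt)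
  open import Relation.Binary.PropositionalEquality using (_≡_; refl; sym; subst; _≢_)
  open import Relation.Nullary using (yes; no)
  open import Induction.WellFounded using (Acc; acc)

  Word : Set
  Word = List (Fin k)

  -- Sequences are kept as lists, the most recent word first.
  -- `Embeds y ws`: some word of ws is a subword of y.
  data Embeds (y : Word) : List Word → Set where
    here  : ∀ {w ws} → w ⊆ y → Embeds y (w ∷ ws)
    there : ∀ {w ws} → Embeds y ws → Embeds y (w ∷ ws)

  data Good : List Word → Set where
    now   : ∀ {w ws} → Embeds w ws → Good (w ∷ ws)
    later : ∀ {w ws} → Good ws → Good (w ∷ ws)

  data Bar (ws : List Word) : Set where
    good : Good ws → Bar ws
    step : (∀ w → Bar (w ∷ ws)) → Bar ws

  bar-[] : ∀ ws → Bar ([] ∷ ws)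
  bar-[] ws = step λ w → good (now (here (minimum w)))

  embeds-cons : ∀ {u ws} a → Embeds u ws → Embeds (a ∷ u) ws
  embeds-cons a (here p)  = here (a ∷ʳ p)
  embeds-cons a (there e) = there (embeds-cons a e)

  -- `Lift a vs zs`: zs arises from vs by prefixing the letter a to the words
  -- of a non-empty initial segment of vs, interleaved with words starting
  -- with other letters; the rest of vs is shared.
  data Lift (a : Fin k) : List Word → List Word → Set where
    lift-last : ∀ {w zs} → Lift a (w ∷ zs) ((a ∷ w) ∷ zs)
    lift-cons : ∀ {w vs zs} → Lift a vs zs → Lift a (w ∷ vs) ((a ∷ w) ∷ zs)
    skip      : ∀ {b w vs zs} → b ≢ a → Lift a vs zs → Lift a vs ((b ∷ w) ∷ zs)

  embeds-lift : ∀ {a vs zs u} → Lift a vs zs → Embeds u vs → Embeds (a ∷ u) zs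
  embeds-lift lift-last     (here p)  = here (refl ∷ p)
  embeds-lift lift-last     (there e) = there (embeds-cons _ e)
  embeds-lift (lift-cons l) (here p)  = here (refl ∷ p)
  embeds-lift (lift-cons l) (there e) = there (embeds-lift l e)
  embeds-lift (skip _ l)    e         = there (embeds-lift l e)

  good-lift : ∀ {a vs zs} → Lift a vs zs → Good vs → Good zs
  good-lift lift-last     (now e)   = now (embeds-cons _ e)
  good-lift lift-last     (later g) = later g
  good-lift (lift-cons l) (now e)   = now (embeds-lift l e)
  good-lift (lift-cons l) (later g) = later (good-lift l g)
  good-lift (skip _ l)    g         = later (good-lift l g)

  -- For each letter we track a "slot": nothing (no word starting with the
  -- letter seen yet) or a sequence vs with a bar proof, lifted into the
  -- current sequence.
  Slot : Set
  Slot = Maybe (Σ (List Word) Bar)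

  data _≺_ : Slot → Slot → Set where
    fill    : ∀ {c} → just c ≺ nothing
    advance : ∀ {w vs h} → just (w ∷ vs , h w) ≺ just (vs , step h)

  acc-just : ∀ vs b → Acc _≺_ (just (vs , b))
  acc-just vs (good g) = acc λ ()
  acc-just vs (step h) = acc λ { (advance {w}) → acc-just (w ∷ vs) (h w) }

  acc-slot : ∀ c → Acc _≺_ c
  acc-slot nothing          = acc λ { (fill {vs , b}) → acc-just vs b }
  acc-slot (just (vs , b)) = acc-just vs b

  data _≺ᵥ_ : ∀ {n} → Vec Slot n → Vec Slot n → Set where
    here  : ∀ {n c' c} {v : Vec Slot n} → c' ≺ c → (c' ∷ v) ≺ᵥ (c ∷ v)
    there : ∀ {n c} {v' v : Vec Slot n} → v' ≺ᵥ v → (c ∷ v') ≺ᵥ (c ∷ v)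

  acc-cons : ∀ {n} c → Acc _≺_ c → (v : Vec Slot n) → Acc _≺ᵥ_ v → Acc _≺ᵥ_ (c ∷ v)
  acc-cons c (acc rc) v (acc rv) = acc λ
    { (here p)  → acc-cons _ (rc p) v (acc rv)
    ; (there q) → acc-cons c (acc rc) _ (rv q) }

  acc-vec : ∀ {n} (v : Vec Slot n) → Acc _≺ᵥ_ v
  acc-vec []      = acc λ ()
  acc-vec (c ∷ v) = acc-cons c (acc-slot c) v (acc-vec v)

  update-≺ᵥ : ∀ {n} (v : Vec Slot n) i c → c ≺ lookup v i → (v [ i ]≔ c) ≺ᵥ v
  update-≺ᵥ (_ ∷ v) zero    c p = here p
  update-≺ᵥ (_ ∷ v) (suc i) c p = there (update-≺ᵥ v i c p)

  LiftsInto : Fin k → Slot → List Word → Set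
  LiftsInto a nothing          zs = ⊤
  LiftsInto a (just (vs , _)) zs = Lift a vs zs

  lifts-skip : ∀ {a b w zs} c → b ≢ a → LiftsInto a c zs → LiftsInto a c ((b ∷ w) ∷ zs)
  lifts-skip nothing  _  _ = tt
  lifts-skip (just _) ne l = skip ne l

  -- Main induction, on the slot vector: appending a word d ∷ ds either
  -- closes a bar (slot d is good) or moves slot d down.
  bar-slots : ∀ zs (v : Vec Slot k) → Acc _≺ᵥ_ v → (∀ a → LiftsInto a (lookup v a) zs) → Bar zs
  bar-slots zs v (acc rs) inv = step extend
    where
    update-inv : ∀ d ds c → LiftsInto d c ((d ∷ ds) ∷ zs) →
                 ∀ a → LiftsInto a (lookup (v [ d ]≔ c) a) ((d ∷ ds) ∷ zs)
    update-inv d ds c l a with a ≟ d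
    ... | yes refl rewrite lookup∘update d v c = l
    ... | no a≢d rewrite lookup∘update′ a≢d v c = lifts-skip (lookup v a) (λ e → a≢d (sym e)) (inv a)

    extend : ∀ w → Bar (w ∷ zs)
    extend []       = bar-[] zs
    extend (d ∷ ds) with lookup v d in eq | inv d
    ... | nothing | _ =
      bar-slots _ (v [ d ]≔ just (ds ∷ zs , extend ds))
        (rs (update-≺ᵥ v d _ (subst (_ ≺_) (sym eq) fill)))
        (update-inv d ds _ lift-last)
    ... | just (vs , good g) | l = good (later (good-lift l g))
    ... | just (vs , step h) | l =
      bar-slots _ (v [ d ]≔ just (ds ∷ vs , h ds))
        (rs (update-≺ᵥ v d _ (subst (_ ≺_) (sym eq) advance)))
        (update-inv d ds _ (lift-cons l))

  higman : Bar []
  higman = bar-slots [] (replicate k nothing) (acc-vec _)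
    (λ a → subst (λ c → LiftsInto a c []) (sym (lookup-replicate a nothing)) tt)


module Automata {m : ℕ} where
  open import Data.Nat using (suc; _+_; _*_; _∸_; _≤_; _<_; z≤n; s≤s)
  open import Data.Nat.Properties
    using (≤-refl; ≤-trans; ≤-<-trans; ≤-pred; m⊓n≤m; m+[n∸m]≡n; +-monoˡ-≤; +-monoˡ-<; n<1+n; _≤?_; ≰⇒>)
  open import Data.Fin using (zero; suc; _≟_; toℕ; combine; remQuot)
  open import Data.Fin.Properties using (pigeonhole; remQuot-combine; any?; toℕ≤n)
  open import Data.Bool using (Bool; true; false; not; _∧_)
  open import Data.List using (List; []; _∷_; _++_; length; take; drop)
  open import Data.List.Properties using (length-take; length-drop; take++drop≡id; length-++)
  open import Data.List.Relation.Binary.Sublist.Propositional using (_⊆_; _∷_; _∷ʳ_; minimum)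
  open import Data.List.Relation.Binary.Sublist.Propositional.Properties using (∷ˡ⁻)
  open import Data.Product using (_×_; proj₁; proj₂)
  open import Data.Empty using (⊥-elim)
  open import Relation.Binary.PropositionalEquality
  open import Relation.Nullary using (Dec; yes; no; ¬_)
  open import Function using (case_of_)
  open DFA

  Word : Set
  Word = List (Fin m)

  run-++ : (A : DFA m) (q : Fin (nQ A)) (u v : Word) → run A q (u ++ v) ≡ run A (run A q u) v
  run-++ A q []      v = refl
  run-++ A q (a ∷ u) v = run-++ A (δ A q a) u v

  withAcc : (A : DFA m) → (Fin (nQ A) → Bool) → DFA m
  withAcc A f = record { nQ = nQ A ; start = start A ; δ = δ A ; acc = f }

  run-withAcc : ∀ A f q w → run (withAcc A f) q w ≡ run A q w
  run-withAcc A f q []      = refl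
  run-withAcc A f q (a ∷ w) = run-withAcc A f (δ A q a) w

  accepts-withAcc : ∀ A f w → Accepts (withAcc A f) w ≡ (f (run A (start A) w) ≡ true)
  accepts-withAcc A f w = cong (λ q → f q ≡ true) (run-withAcc A f (start A) w)

  universal : DFA m
  universal = record { nQ = 1 ; start = zero ; δ = λ _ _ → zero ; acc = λ _ → true }

  complement : DFA m → DFA m
  complement A = withAcc A (λ q → not (acc A q))

  not-true : ∀ {b} → not b ≡ true → ¬ b ≡ true
  not-true {true} () refl

  true-not : ∀ {b} → ¬ b ≡ true → not b ≡ true
  true-not {true}  h = ⊥-elim (h refl)
  true-not {false} h = refl

  complement⁺ : ∀ A w → ¬ Accepts A w → Accepts (complement A) w
  complement⁺ A w h = subst (λ P → P) (sym (accepts-withAcc A (λ q → not (acc A q)) w)) (true-not h)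

  complement⁻ : ∀ A w → Accepts (complement A) w → ¬ Accepts A w
  complement⁻ A w h = not-true (subst (λ P → P) (accepts-withAcc A (λ q → not (acc A q)) w) h)

  appendLetter : DFA m → Fin m → DFA m
  appendLetter A a = withAcc A (λ q → acc A (δ A q a))

  appendLetter-accepts : ∀ A a w → Accepts (appendLetter A a) w ≡ Accepts A (w ++ a ∷ [])
  appendLetter-accepts A a w =
    trans (accepts-withAcc A (λ q → acc A (δ A q a)) w) (cong (λ q → acc A q ≡ true) (sym (run-++ A (start A) w (a ∷ []))))

  -- State 0
  -- is the start, state 1 a rejecting sink, states 2+q copy A.
  prefixLetter : Fin m → DFA m → DFA m
  prefixLetter a A = record { nQ = suc (suc (nQ A)) ; start = zero ; δ = d ; acc = ac }
    where
    d : Fin (suc (suc (nQ A))) → Fin m → Fin (suc (suc (nQ A)))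
    d zero b with b ≟ a
    ... | yes _ = suc (suc (start A))
    ... | no _  = suc zero
    d (suc zero)    b = suc zero
    d (suc (suc q)) b = suc (suc (δ A q b))
    ac : Fin (suc (suc (nQ A))) → Bool
    ac zero          = false
    ac (suc zero)    = false
    ac (suc (suc q)) = acc A q

  run-prefix-copy : ∀ a A q w → run (prefixLetter a A) (suc (suc q)) w ≡ suc (suc (run A q w))
  run-prefix-copy a A q []      = refl
  run-prefix-copy a A q (b ∷ w) = run-prefix-copy a A (δ A q b) w

  run-prefix-sink : ∀ a A w → run (prefixLetter a A) (suc zero) w ≡ suc zero
  run-prefix-sink a A []      = refl
  run-prefix-sink a A (b ∷ w) = run-prefix-sink a A w

  prefixLetter⁺ : ∀ a A w → Accepts A w → Accepts (prefixLetter a A) (a ∷ w)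
  prefixLetter⁺ a A w h with a ≟ a
  ... | yes _ rewrite run-prefix-copy a A (start A) w = h
  ... | no a≢a = ⊥-elim (a≢a refl)

  prefixLetter⁻ : ∀ a A v → Accepts (prefixLetter a A) v → Σ Word λ w → v ≡ a ∷ w × Accepts A w
  prefixLetter⁻ a A [] ()
  prefixLetter⁻ a A (b ∷ w) h with b ≟ a
  ... | yes refl rewrite run-prefix-copy a A (start A) w = w , refl , h
  ... | no _ rewrite run-prefix-sink a A w = case h of λ ()

  product : DFA m → DFA m → DFA m
  product A B = record
    { nQ    = nQ A * nQ B
    ; start = combine (start A) (start B)
    ; δ     = λ i a → combine (δ A (left i) a) (δ B (right i) a)
    ; acc   = λ i → acc A (left i) ∧ acc B (right i) }
    where
    left : Fin (nQ A * nQ B) → Fin (nQ A)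
    left i = proj₁ (remQuot {nQ A} (nQ B) i)
    right : Fin (nQ A * nQ B) → Fin (nQ B)
    right i = proj₂ (remQuot {nQ A} (nQ B) i)

  run-product : ∀ A B p q w → run (product A B) (combine p q) w ≡ combine (run A p w) (run B q w)
  run-product A B p q []      = refl
  run-product A B p q (a ∷ w) =
    trans (cong (λ r → run (product A B) (combine (δ A (proj₁ r) a) (δ B (proj₂ r) a)) w)
                (remQuot-combine {nQ A} {nQ B} p q))
          (run-product A B (δ A p a) (δ B q a) w)

  accepts-product : ∀ A B w →
    Accepts (product A B) w ≡ (acc A (run A (start A) w) ∧ acc B (run B (start B) w) ≡ true)
  accepts-product A B w = begin
    Accepts (product A B) w
      ≡⟨ cong (λ i → acc (product A B) i ≡ true) (run-product A B (start A) (start B) w) ⟩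
    (acc (product A B) (combine (run A (start A) w) (run B (start B) w)) ≡ true)
      ≡⟨ cong (λ r → acc A (proj₁ r) ∧ acc B (proj₂ r) ≡ true)
              (remQuot-combine {nQ A} {nQ B} (run A (start A) w) (run B (start B) w)) ⟩
    (acc A (run A (start A) w) ∧ acc B (run B (start B) w) ≡ true) ∎
    where open ≡-Reasoning

  ∧-true⁻ : ∀ {x y} → x ∧ y ≡ true → x ≡ true × y ≡ true
  ∧-true⁻ {true} e = refl , e

  ∧-true⁺ : ∀ {x y} → x ≡ true → y ≡ true → x ∧ y ≡ true
  ∧-true⁺ refl refl = refl

  product⁺ : ∀ A B w → Accepts A w → Accepts B w → Accepts (product A B) w
  product⁺ A B w a b = subst (λ P → P) (sym (accepts-product A B w)) (∧-true⁺ a b)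

  product⁻ : ∀ A B w → Accepts (product A B) w → Accepts A w × Accepts B w
  product⁻ A B w h = ∧-true⁻ (subst (λ P → P) (accepts-product A B w) h)

  -- Upward closure of a single word b: the words having b as a subword.
  -- State i means "the first i letters of b have been matched".
  aboveStep : (b : Word) → Fin (suc (length b)) → Fin m → Fin (suc (length b))
  aboveStep []      q       a = zero
  aboveStep (c ∷ b) zero    a with a ≟ c
  ... | yes _ = suc zero
  ... | no _  = zero
  aboveStep (c ∷ b) (suc q) a = suc (aboveStep b q a)

  aboveAcc : (b : Word) → Fin (suc (length b)) → Bool
  aboveAcc []      q       = true
  aboveAcc (c ∷ b) zero    = false
  aboveAcc (c ∷ b) (suc q) = aboveAcc b q

  above : Word → DFA m
  above b = record { nQ = suc (length b) ; start = zero ; δ = aboveStep b ; acc = aboveAcc b }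

  run-above-suc : ∀ c b q w → run (above (c ∷ b)) (suc q) w ≡ suc (run (above b) q w)
  run-above-suc c b q []      = refl
  run-above-suc c b q (a ∷ w) = run-above-suc c b (aboveStep b q a) w

  -- Greedy matching is complete for the subword order.
  above⁺ : ∀ b w → b ⊆ w → Accepts (above b) w
  above⁺ []      w       p = refl
  above⁺ (c ∷ b) (a ∷ w) p with a ≟ c
  above⁺ (c ∷ b) (a ∷ w) (.a ∷ʳ p) | yes refl rewrite run-above-suc c b zero w = above⁺ b w (∷ˡ⁻ p)
  above⁺ (c ∷ b) (a ∷ w) (refl ∷ p) | yes refl rewrite run-above-suc c b zero w = above⁺ b w p
  above⁺ (c ∷ b) (a ∷ w) (.a ∷ʳ p) | no _ = above⁺ (c ∷ b) w p
  above⁺ (c ∷ b) (a ∷ w) (refl ∷ p) | no a≢a = ⊥-elim (a≢a refl)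

  above⁻ : ∀ b w → Accepts (above b) w → b ⊆ w
  above⁻ []      w       h = minimum w
  above⁻ (c ∷ b) []      ()
  above⁻ (c ∷ b) (a ∷ w) h with a ≟ c
  ... | yes refl rewrite run-above-suc c b zero w = refl ∷ above⁻ b w h
  ... | no _ = a ∷ʳ above⁻ (c ∷ b) w h

  cut-loop : ∀ A q (w : Word) i j → i < j → j ≤ length w →
             run A q (take i w) ≡ run A q (take j w) →
             length (take i w ++ drop j w) < length w × run A q (take i w ++ drop j w) ≡ run A q w
  cut-loop A q w i j i<j j≤∣w∣ loop = shorter , same-state
    where
    shorter : length (take i w ++ drop j w) < length w
    shorter rewrite length-++ (take i w) {drop j w} | length-take i w | length-drop j w =
      ≤-<-trans (+-monoˡ-≤ (length w ∸ j) (m⊓n≤m i (length w)))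
        (subst (i + (length w ∸ j) <_) (m+[n∸m]≡n j≤∣w∣) (+-monoˡ-< (length w ∸ j) i<j))
    same-state : run A q (take i w ++ drop j w) ≡ run A q w
    same-state = begin
      run A q (take i w ++ drop j w)        ≡⟨ run-++ A q (take i w) (drop j w) ⟩
      run A (run A q (take i w)) (drop j w) ≡⟨ cong (λ r → run A r (drop j w)) loop ⟩
      run A (run A q (take j w)) (drop j w) ≡⟨ sym (run-++ A q (take j w) (drop j w)) ⟩
      run A q (take j w ++ drop j w)        ≡⟨ cong (run A q) (take++drop≡id j w) ⟩
      run A q w                             ∎
      where open ≡-Reasoning

  -- Every reachable state is reachable by a word of length at most nQ A
  -- (induction on a length bound; the pigeonhole principle finds a loop).
  short-word : ∀ A q bound (w : Word) → length w ≤ bound →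
               Σ Word λ w' → length w' ≤ nQ A × run A q w' ≡ run A q w
  short-word A q 0 w ∣w∣≤0 = w , ≤-trans ∣w∣≤0 z≤n , refl
  short-word A q (suc bound) w ∣w∣≤ with length w ≤? nQ A
  ... | yes ∣w∣≤n = w , ∣w∣≤n , refl
  ... | no ∣w∣≰n with pigeonhole (n<1+n (nQ A)) (λ i → run A q (take (toℕ i) w))
  ...   | i , j , i<j , loop with cut-loop A q w (toℕ i) (toℕ j) i<j (≤-trans (toℕ≤n j) (≰⇒> ∣w∣≰n)) loop
  ...     | shorter , same with short-word A q bound (take (toℕ i) w ++ drop (toℕ j) w) (≤-pred (≤-trans shorter ∣w∣≤))
  ...       | w' , ∣w'∣≤n , same' = w' , ∣w'∣≤n , trans same' same

  accepts-within? : ∀ A n q → Dec (Σ Word λ w → length w ≤ n × acc A (run A q w) ≡ true)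
  accepts-within? A n q with acc A q in eq
  ... | true = yes ([] , z≤n , eq)
  accepts-within? A 0 q | false =
    no λ { ([] , _ , e) → case trans (sym eq) e of λ () }
  accepts-within? A (suc n) q | false with any? (λ a → accepts-within? A n (δ A q a))
  ... | yes (a , w , ∣w∣≤n , e) = yes (a ∷ w , s≤s ∣w∣≤n , e)
  ... | no none = no λ { ([] , _ , e) → case trans (sym eq) e of λ ()
                       ; (a ∷ w , s≤s ∣w∣≤n , e) → none (a , w , ∣w∣≤n , e) }

  nonempty? : (A : DFA m) → Dec (Σ Word (Accepts A))
  nonempty? A with accepts-within? A (nQ A) (start A)
  ... | yes (w , _ , e) = yes (w , e)
  ... | no none = no λ (w , e) →
    let (w' , ∣w'∣≤n , same) = short-word A (start A) (length w) w ≤-refl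
    in none (w' , ∣w'∣≤n , trans (cong (acc A) same) e)


module RegularContents {nC nM : ℕ} where
  open Automata {nM}
  open import Data.Fin using (_≟_)
  open import Data.Fin.Properties using (all?; any?)
  open import Data.Bool using (true)
  import Data.Bool.Properties as Bool
  open import Data.List as List using (List; []; _∷_; _++_)
  open import Data.List.Relation.Binary.Sublist.Propositional using (_⊆_)
  open import Data.List.Relation.Unary.Any as Any using (Any; here; there)
  open import Data.List.Relation.Unary.Any.Properties using (map⁺; map⁻; tabulate⁺; tabulate⁻; ++⁺ˡ; ++⁺ʳ; ++⁻)
  open import Data.Vec as Vec using (Vec; lookup; _[_]≔_; replicate; zipWith; tabulate)
  open import Data.Vec.Properties using (lookup∘update; lookup∘update′; lookup-replicate; lookup-zipWith; lookup-map; lookup∘tabulate)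
  open import Data.Product using (_×_; proj₁; proj₂)
  open import Data.Sum using (inj₁; inj₂)
  open import Data.Empty using (⊥-elim)
  open import Relation.Binary.PropositionalEquality
  open import Relation.Nullary using (Dec; yes; no; ¬_; ¬?)
  open import Relation.Nullary.Decidable using (decidable-stable)

  Channels : Set
  Channels = Vec (List (Fin nM)) nC

  Regular : Set
  Regular = RegContents nC nM

  Box : Set
  Box = Vec (DFA nM) nC

  _∈□_ : Channels → Box → Set
  x ∈□ v = ∀ c → Accepts (lookup v c) (lookup x c)

  accepts? : (A : DFA nM) (w : List (Fin nM)) → Dec (Accepts A w)
  accepts? A w = DFA.acc A (run A (DFA.start A) w) Bool.≟ true

  ∈□? : ∀ x v → Dec (x ∈□ v)
  ∈□? x v = all? (λ c → accepts? (lookup v c) (lookup x c))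

  ∈? : ∀ x (R : Regular) → Dec (⟦ R ⟧C x)
  ∈? x R = Any.any? (∈□? x) R

  update⁺ : ∀ v c A x → Accepts A (lookup x c) →
            (∀ c' → c' ≢ c → Accepts (lookup v c') (lookup x c')) → x ∈□ (v [ c ]≔ A)
  update⁺ v c A x a rest c' with c' ≟ c
  ... | yes refl = subst (λ D → Accepts D (lookup x c)) (sym (lookup∘update c v A)) a
  ... | no c'≢c = subst (λ D → Accepts D (lookup x c')) (sym (lookup∘update′ c'≢c v A)) (rest c' c'≢c)

  update⁻ : ∀ v c A x → x ∈□ (v [ c ]≔ A) →
            Accepts A (lookup x c) × (∀ c' → c' ≢ c → Accepts (lookup v c') (lookup x c'))
  update⁻ v c A x h =
    subst (λ D → Accepts D (lookup x c)) (lookup∘update c v A) (h c) ,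
    λ c' c'≢c → subst (λ D → Accepts D (lookup x c')) (lookup∘update′ c'≢c v A) (h c')

  everywhere : Box
  everywhere = replicate nC universal

  ∈everywhere : ∀ x → x ∈□ everywhere
  ∈everywhere x c rewrite lookup-replicate c universal = refl

  everything : Regular
  everything = everywhere ∷ []

  _∩□_ : Box → Box → Box
  _∩□_ = zipWith product

  ∩□⁺ : ∀ v u x → x ∈□ v → x ∈□ u → x ∈□ (v ∩□ u)
  ∩□⁺ v u x p q c rewrite lookup-zipWith product c v u =
    product⁺ (lookup v c) (lookup u c) (lookup x c) (p c) (q c)

  ∩□⁻ : ∀ v u x → x ∈□ (v ∩□ u) → x ∈□ v × x ∈□ u
  ∩□⁻ v u x h = (λ c → proj₁ (both c)) , (λ c → proj₂ (both c))
    where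
    both : ∀ c → Accepts (lookup v c) (lookup x c) × Accepts (lookup u c) (lookup x c)
    both c = product⁻ (lookup v c) (lookup u c) (lookup x c)
               (subst (λ D → Accepts D (lookup x c)) (lookup-zipWith product c v u) (h c))

  _∩_ : Regular → Regular → Regular
  []      ∩ S = []
  (v ∷ R) ∩ S = List.map (v ∩□_) S ++ (R ∩ S)

  ∩⁺ : ∀ R S x → ⟦ R ⟧C x → ⟦ S ⟧C x → ⟦ R ∩ S ⟧C x
  ∩⁺ (v ∷ R) S x (here p)  q = ++⁺ˡ (map⁺ (Any.map (λ {u} → ∩□⁺ v u x p) q))
  ∩⁺ (v ∷ R) S x (there p) q = ++⁺ʳ (List.map (v ∩□_) S) (∩⁺ R S x p q)

  ∩⁻ : ∀ R S x → ⟦ R ∩ S ⟧C x → ⟦ R ⟧C x × ⟦ S ⟧C x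
  ∩⁻ (v ∷ R) S x h with ++⁻ (List.map (v ∩□_) S) h
  ... | inj₁ q = let r = Any.map (λ {u} → ∩□⁻ v u x) (map⁻ q)
                 in here (proj₁ (proj₂ (Any.satisfied r))) , Any.map proj₂ r
  ... | inj₂ q = let (r , s) = ∩⁻ R S x q in there r , s

  -- Complement: a box is left exactly when one component is left.
  outside□ : Box → Regular
  outside□ v = List.tabulate (λ c → everywhere [ c ]≔ complement (lookup v c))

  outside□⁺ : ∀ v x c → ¬ Accepts (lookup v c) (lookup x c) → ⟦ outside□ v ⟧C x
  outside□⁺ v x c h = tabulate⁺ c
    (update⁺ everywhere c _ x (complement⁺ (lookup v c) (lookup x c) h) (λ c' _ → ∈everywhere x c'))

  outside□⁻ : ∀ v x → ⟦ outside□ v ⟧C x → ¬ x ∈□ v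
  outside□⁻ v x h x∈v with tabulate⁻ h
  ... | c , m = complement⁻ (lookup v c) (lookup x c) (proj₁ (update⁻ everywhere c _ x m)) (x∈v c)

  complementR : Regular → Regular
  complementR []      = everything
  complementR (v ∷ R) = outside□ v ∩ complementR R

  complementR⁺ : ∀ R x → ¬ ⟦ R ⟧C x → ⟦ complementR R ⟧C x
  complementR⁺ []      x _ = here (∈everywhere x)
  complementR⁺ (v ∷ R) x x∉ with any? (λ c → ¬? (accepts? (lookup v c) (lookup x c)))
  ... | yes (c , rejects) = ∩⁺ (outside□ v) (complementR R) x (outside□⁺ v x c rejects)
                              (complementR⁺ R x (λ m → x∉ (there m)))
  ... | no none = ⊥-elim (x∉ (here λ c → decidable-stable (accepts? (lookup v c) (lookup x c)) (λ r → none (c , r))))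

  complementR⁻ : ∀ R x → ⟦ complementR R ⟧C x → ¬ ⟦ R ⟧C x
  complementR⁻ (v ∷ R) x h (here m)  = outside□⁻ v x (proj₁ (∩⁻ (outside□ v) (complementR R) x h)) m
  complementR⁻ (v ∷ R) x h (there m) = complementR⁻ R x (proj₂ (∩⁻ (outside□ v) (complementR R) x h)) m

  above□ : Channels → Box
  above□ b = Vec.map above b

  above□⁺ : ∀ b x → (∀ c → lookup b c ⊆ lookup x c) → x ∈□ above□ b
  above□⁺ b x b⪯x c rewrite lookup-map c above b = above⁺ (lookup b c) (lookup x c) (b⪯x c)

  above□⁻ : ∀ b x → x ∈□ above□ b → ∀ c → lookup b c ⊆ lookup x c
  above□⁻ b x h c = above⁻ (lookup b c) (lookup x c) (subst (λ D → Accepts D (lookup x c)) (lookup-map c above b) (h c))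

  nonempty□? : ∀ v → Dec (Σ Channels (_∈□ v))
  nonempty□? v with all? (λ c → nonempty? (lookup v c))
  ... | yes ne = yes (tabulate (λ c → proj₁ (ne c)) ,
                      λ c → subst (Accepts (lookup v c)) (sym (lookup∘tabulate (λ c → proj₁ (ne c)) c)) (proj₂ (ne c)))
  ... | no ¬ne = no λ (x , m) → ¬ne (λ c → lookup x c , m c)

  nonemptyR? : ∀ (R : Regular) → Dec (Σ Channels ⟦ R ⟧C)
  nonemptyR? []      = no λ ()
  nonemptyR? (v ∷ R) with nonempty□? v | nonemptyR? R
  ... | yes (x , m) | _          = yes (x , here m)
  ... | no _        | yes (x , m) = yes (x , there m)
  ... | no ¬v       | no ¬R      = no λ { (x , here m) → ¬v (x , m) ; (x , there m) → ¬R (x , m) }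

  appendTo : Fin nC → Fin nM → Channels → Channels
  appendTo c m x = x [ c ]≔ (lookup x c ++ m ∷ [])

  sendPre : Fin nC → Fin nM → Box → Box
  sendPre c m v = v [ c ]≔ appendLetter (lookup v c) m

  sendPre⁺ : ∀ c m v x → appendTo c m x ∈□ v → x ∈□ sendPre c m v
  sendPre⁺ c m v x h = update⁺ v c _ x
    (subst (λ P → P) (sym (appendLetter-accepts (lookup v c) m (lookup x c)))
      (subst (Accepts (lookup v c)) (lookup∘update c x _) (h c)))
    (λ c' c'≢c → subst (Accepts (lookup v c')) (lookup∘update′ c'≢c x _) (h c'))

  sendPre⁻ : ∀ c m v x → x ∈□ sendPre c m v → appendTo c m x ∈□ v
  sendPre⁻ c m v x h c' with update⁻ v c _ x h | c' ≟ c
  ... | here-c , _ | yes refl = subst (Accepts (lookup v c)) (sym (lookup∘update c x _))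
                                  (subst (λ P → P) (appendLetter-accepts (lookup v c) m (lookup x c)) here-c)
  ... | _ , rest | no c'≢c = subst (Accepts (lookup v c')) (sym (lookup∘update′ c'≢c x _)) (rest c' c'≢c)

  recvPre : Fin nC → Fin nM → Box → Box
  recvPre c m v = v [ c ]≔ prefixLetter m (lookup v c)

  recvPre⁺ : ∀ c m v x w → lookup x c ≡ m ∷ w → (x [ c ]≔ w) ∈□ v → x ∈□ recvPre c m v
  recvPre⁺ c m v x w x≡mw h = update⁺ v c _ x
    (subst (Accepts (prefixLetter m (lookup v c))) (sym x≡mw)
      (prefixLetter⁺ m (lookup v c) w (subst (Accepts (lookup v c)) (lookup∘update c x w) (h c))))
    (λ c' c'≢c → subst (Accepts (lookup v c')) (lookup∘update′ c'≢c x w) (h c'))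

  recvPre⁻ : ∀ c m v x → x ∈□ recvPre c m v →
             Σ (List (Fin nM)) λ w → lookup x c ≡ m ∷ w × (x [ c ]≔ w) ∈□ v
  recvPre⁻ c m v x h with update⁻ v c _ x h
  ... | here-c , rest with prefixLetter⁻ m (lookup v c) (lookup x c) here-c
  ...   | w , x≡mw , a = w , x≡mw , removed
    where
    removed : (x [ c ]≔ w) ∈□ v
    removed c' with c' ≟ c
    ... | yes refl = subst (Accepts (lookup v c)) (sym (lookup∘update c x w)) a
    ... | no c'≢c = subst (Accepts (lookup v c')) (sym (lookup∘update′ c'≢c x w)) (rest c' c'≢c)

  startsWith : Fin nC → Fin nM → Box
  startsWith c m = everywhere [ c ]≔ prefixLetter m universal

  startsWith⁺ : ∀ c m x w → lookup x c ≡ m ∷ w → x ∈□ startsWith c m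
  startsWith⁺ c m x w x≡mw = update⁺ everywhere c _ x
    (subst (Accepts (prefixLetter m universal)) (sym x≡mw) (prefixLetter⁺ m universal w refl))
    (λ c' _ → ∈everywhere x c')

  startsWith⁻ : ∀ c m x → x ∈□ startsWith c m → Σ (List (Fin nM)) λ w → lookup x c ≡ m ∷ w
  startsWith⁻ c m x h with prefixLetter⁻ m universal (lookup x c) (proj₁ (update⁻ everywhere c _ x h))
  ... | w , x≡mw , _ = w , x≡mw

  notStartsWith : Fin nC → Fin nM → Box
  notStartsWith c m = everywhere [ c ]≔ complement (prefixLetter m universal)

  notStartsWith⁺ : ∀ c m x → (∀ w → lookup x c ≢ m ∷ w) → x ∈□ notStartsWith c m
  notStartsWith⁺ c m x ¬start = update⁺ everywhere c _ x
    (complement⁺ (prefixLetter m universal) (lookup x c)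
      (λ a → let (w , x≡mw , _) = prefixLetter⁻ m universal (lookup x c) a in ¬start w x≡mw))
    (λ c' _ → ∈everywhere x c')

  notStartsWith⁻ : ∀ c m x → x ∈□ notStartsWith c m → ∀ w → lookup x c ≢ m ∷ w
  notStartsWith⁻ c m x h w x≡mw =
    complement⁻ (prefixLetter m universal) (lookup x c) (proj₁ (update⁻ everywhere c _ x h))
      (subst (Accepts (prefixLetter m universal)) (sym x≡mw) (prefixLetter⁺ m universal w refl))


-- Encoding a pair (state, channel contents) as one word, so that the
-- subword order on encodings reflects "same state and componentwise
-- subword".  This lets Higman's lemma over a single alphabet bound the
-- saturation.
module Encoding (nS nM : ℕ) where
  open import Data.Nat using (suc; _+_; _≤_; z≤n; s≤s)
  open import Data.Nat.Properties using (m≤n⇒m≤1+n; 1+n≰n)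
  open import Data.Fin using (zero; suc; _↑ˡ_; _↑ʳ_; splitAt)
  open import Data.Fin.Properties using (splitAt-↑ˡ; splitAt-↑ʳ; ↑ˡ-injective; ↑ʳ-injective; suc-injective)
  open import Data.List using (List; []; _∷_; _++_; map)
  open import Data.List.Relation.Binary.Sublist.Propositional using (_⊆_; []; _∷_; _∷ʳ_; minimum; ⊆-refl; ⊆-trans)
  open import Data.List.Relation.Binary.Sublist.Heterogeneous using (toAny)
  open import Data.List.Relation.Binary.Sublist.Heterogeneous.Properties using (++ˡ)
  open import Data.List.Relation.Unary.Any using (Any; here; there; satisfied)
  open import Data.List.Relation.Unary.Any.Properties using (++⁻) renaming (map⁻ to any-map⁻)
  open import Data.Vec using (Vec; []; _∷_; lookup)
  open import Data.Product using (_×_; proj₂; map₁)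
  open import Data.Sum using (inj₁; inj₂)
  open import Data.Empty using (⊥; ⊥-elim)
  open import Function using (case_of_)
  open import Relation.Binary.PropositionalEquality
  open import Relation.Nullary using (¬_)

  K : ℕ
  K = suc (nS + nM)

  sep : Fin K
  sep = zero

  state : Fin nS → Fin K
  state s = suc (s ↑ˡ nM)

  message : Fin nM → Fin K
  message a = suc (nS ↑ʳ a)

  state≢message : ∀ s a → state s ≢ message a
  state≢message s a e = case trans (sym (splitAt-↑ˡ nS s nM))
                                   (trans (cong (splitAt nS) (suc-injective e)) (splitAt-↑ʳ nS nM a)) of λ ()

  message-injective : ∀ {a a'} → message a ≡ message a' → a ≡ a'
  message-injective e = ↑ʳ-injective nS _ _ (suc-injective e)

  encodeChannel : List (Fin nM) → List (Fin K)
  encodeChannel = map message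

  encodeChannels : ∀ {n} → Vec (List (Fin nM)) n → List (Fin K)
  encodeChannels []      = []
  encodeChannels (w ∷ x) = encodeChannel w ++ sep ∷ encodeChannels x

  encode : ∀ {n} → Fin nS × Vec (List (Fin nM)) n → List (Fin K)
  encode (s , x) = state s ∷ encodeChannels x

  seps : List (Fin K) → ℕ
  seps []          = 0
  seps (zero  ∷ r) = suc (seps r)
  seps (suc _ ∷ r) = seps r

  seps-mono : ∀ {r r'} → r ⊆ r' → seps r ≤ seps r'
  seps-mono []                         = z≤n
  seps-mono (zero  ∷ʳ p)               = m≤n⇒m≤1+n (seps-mono p)
  seps-mono (suc _ ∷ʳ p)               = seps-mono p
  seps-mono (_∷_ {x = zero}  refl p)   = s≤s (seps-mono p)
  seps-mono (_∷_ {x = suc _} refl p)   = seps-mono p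

  seps-channel : ∀ w r → seps (encodeChannel w ++ r) ≡ seps r
  seps-channel []      r = refl
  seps-channel (a ∷ w) r = seps-channel w r

  seps-channels : ∀ {n} (x : Vec (List (Fin nM)) n) → seps (encodeChannels x) ≡ n
  seps-channels []      = refl
  seps-channels (w ∷ x) = trans (seps-channel w _) (cong suc (seps-channels x))

  -- With equally many separators left, a separator cannot be skipped.
  sep-excess : ∀ {r r'} → sep ∷ r ⊆ r' → seps r ≡ seps r' → ⊥
  sep-excess {r} p e = 1+n≰n (subst (suc (seps r) ≤_) (sym e) (seps-mono p))

  split : ∀ u u' {r r'} → encodeChannel u ++ sep ∷ r ⊆ encodeChannel u' ++ sep ∷ r' →
          seps r ≡ seps r' → u ⊆ u' × r ⊆ r'
  split []      []       (_ ∷ʳ p)   e = ⊥-elim (sep-excess p e)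
  split []      []       (refl ∷ p) e = [] , p
  split []      (b ∷ u') (_ ∷ʳ p)   e = minimum _ , proj₂ (split [] u' p e)
  split []      (b ∷ u') (() ∷ p)   e
  split (a ∷ u) []       (_ ∷ʳ p)   e = ⊥-elim (sep-excess (⊆-trans (++ˡ (encodeChannel (a ∷ u)) ⊆-refl) p) e)
  split (a ∷ u) []       (() ∷ p)   e
  split (a ∷ u) (b ∷ u') (_ ∷ʳ p)   e = map₁ (b ∷ʳ_) (split (a ∷ u) u' p e)
  split (a ∷ u) (b ∷ u') (a≡b ∷ p)  e = map₁ (message-injective a≡b ∷_) (split u u' p e)

  decode-channels : ∀ {n} (x x' : Vec (List (Fin nM)) n) → encodeChannels x ⊆ encodeChannels x' →
                    ∀ c → lookup x c ⊆ lookup x' c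
  decode-channels (w ∷ x) (w' ∷ x') p c
    with split w w' p (trans (seps-channels x) (sym (seps-channels x')))
  decode-channels (w ∷ x) (w' ∷ x') p zero    | w⊆w' , _ = w⊆w'
  decode-channels (w ∷ x) (w' ∷ x') p (suc c) | _ , q   = decode-channels x x' q c

  state∉channels : ∀ {n} s (x : Vec (List (Fin nM)) n) → ¬ Any (state s ≡_) (encodeChannels x)
  state∉channels s []      ()
  state∉channels s (w ∷ x) h with ++⁻ (encodeChannel w) h
  ... | inj₁ inW          = let (a , e) = satisfied (any-map⁻ inW) in state≢message s a e
  ... | inj₂ (here ())
  ... | inj₂ (there rest) = state∉channels s x rest

  decode : ∀ {n} s s' (x x' : Vec (List (Fin nM)) n) → encode (s , x) ⊆ encode (s' , x') →
           s ≡ s' × (∀ c → lookup x c ⊆ lookup x' c)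
  decode s s' x x' (_ ∷ʳ p) = ⊥-elim (state∉channels s x' (toAny p))
  decode s s' x x' (e ∷ p)  = ↑ˡ-injective nM s s' (suc-injective e) , decode-channels x x' p


module Moves (L : SGLCS) where
  open SGLCS L renaming (trans to transitions)
  open RegularContents {nC} {nM}
  open import Data.Fin using (zero; suc; _≟_)
  open import Data.List as List using (List; []; _∷_; _++_)
  open import Data.List.Membership.Propositional using (_∈_)
  open import Data.List.Relation.Unary.Any as Any using (Any; here; there)
  open import Data.List.Relation.Unary.Any.Properties using (map⁺; map⁻; ++⁺ˡ; ++⁺ʳ; ++⁻)
  open import Data.Vec using (lookup; _[_]≔_)
  open import Data.Product using (_×_; proj₁; proj₂)
  open import Data.Sum using (inj₁; inj₂)
  open import Data.Empty using (⊥-elim)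
  open import Function using (case_of_)
  open import Relation.Binary.PropositionalEquality
  open import Relation.Nullary using (Dec; yes; no; ¬_)

  Transition : Set
  Transition = Fin nS × Op nC nM × Fin nS

  data Effect : Op nC nM → Channels → Channels → Set where
    nop  : ∀ {x} → Effect nop x x
    send : ∀ {c m x} → Effect (send c m) x (appendTo c m x)
    recv : ∀ {c m x w} → lookup x c ≡ m ∷ w → Effect (recv c m) x (x [ c ]≔ w)

  effect-step : ∀ {s op s' x y} → (s , op , s') ∈ transitions → Effect op x y →
                Step L (s , x , suc zero) (s' , y , zero)
  effect-step t nop      = step-nop t
  effect-step t send     = step-send t
  effect-step t (recv e) = step-recv t e

  effect-enabled : ∀ {op x y} → Effect op x y → Enabled L x op
  effect-enabled nop                        = en-nop
  effect-enabled (send {c} {m})             = en-send c m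
  effect-enabled (recv {c} {m} {x} {w} e)   = en-recv c m w e

  enabled-effect : ∀ {op x} → Enabled L x op → Σ Channels (Effect op x)
  enabled-effect en-nop             = _ , nop
  enabled-effect (en-send c m)      = _ , send
  enabled-effect (en-recv c m w e) = _ , recv e

  effect-functional : ∀ {op x y y'} → Effect op x y → Effect op x y' → y ≡ y'
  effect-functional nop      nop       = refl
  effect-functional send     send      = refl
  effect-functional (recv e) (recv e') with trans (sym e) e'
  ... | refl = refl

  pre : Op nC nM → Regular → Regular
  pre nop        R = R
  pre (send c m) R = List.map (sendPre c m) R
  pre (recv c m) R = List.map (recvPre c m) R

  pre⁺ : ∀ op R x y → Effect op x y → ⟦ R ⟧C y → ⟦ pre op R ⟧C x
  pre⁺ nop        R x _ nop               h = h
  pre⁺ (send c m) R x _ send              h = map⁺ (Any.map (λ {v} → sendPre⁺ c m v x) h)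
  pre⁺ (recv c m) R x _ (recv {w = w} e) h = map⁺ (Any.map (λ {v} → recvPre⁺ c m v x w e) h)

  pre⁻ : ∀ op R x → ⟦ pre op R ⟧C x → Σ Channels λ y → Effect op x y × ⟦ R ⟧C y
  pre⁻ nop        R x h = x , nop , h
  pre⁻ (send c m) R x h = _ , send , Any.map (λ {v} → sendPre⁻ c m v x) (map⁻ h)
  pre⁻ (recv c m) R x h with Any.satisfied (map⁻ h)
  ... | v , x∈v with recvPre⁻ c m v x x∈v
  ...   | w , e , _ = _ , recv e , Any.map (λ {v'} → removed {v'}) (map⁻ h)
    where
    -- all boxes agree on the received message, since x determines it
    removed : ∀ {v'} → x ∈□ recvPre c m v' → (x [ c ]≔ w) ∈□ v'
    removed {v'} x∈v' with recvPre⁻ c m v' x x∈v'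
    ... | w' , e' , r with trans (sym e') e
    ...   | refl = r

  enabledR : Op nC nM → Regular
  enabledR (recv c m) = startsWith c m ∷ []
  enabledR nop        = everything
  enabledR (send c m) = everything

  disabledR : Op nC nM → Regular
  disabledR (recv c m) = notStartsWith c m ∷ []
  disabledR nop        = []
  disabledR (send c m) = []

  enabledR⁺ : ∀ x op → Enabled L x op → ⟦ enabledR op ⟧C x
  enabledR⁺ x nop        _                  = here (∈everywhere x)
  enabledR⁺ x (send c m) _                  = here (∈everywhere x)
  enabledR⁺ x (recv c m) (en-recv _ _ w e) = here (startsWith⁺ c m x w e)

  enabledR⁻ : ∀ x op → ⟦ enabledR op ⟧C x → Enabled L x op
  enabledR⁻ x nop        _        = en-nop
  enabledR⁻ x (send c m) _        = en-send c m
  enabledR⁻ x (recv c m) (here h) = let (w , e) = startsWith⁻ c m x h in en-recv c m w e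

  disabledR⁺ : ∀ x op → ¬ Enabled L x op → ⟦ disabledR op ⟧C x
  disabledR⁺ x nop        ¬en = ⊥-elim (¬en en-nop)
  disabledR⁺ x (send c m) ¬en = ⊥-elim (¬en (en-send c m))
  disabledR⁺ x (recv c m) ¬en = here (notStartsWith⁺ c m x λ w e → ¬en (en-recv c m w e))

  disabledR⁻ : ∀ x op → ⟦ disabledR op ⟧C x → ¬ Enabled L x op
  disabledR⁻ x (recv c m) (here h) (en-recv _ _ w e) = notStartsWith⁻ c m x h w e

  enabled? : ∀ x op → Dec (Enabled L x op)
  enabled? x nop        = yes en-nop
  enabled? x (send c m) = yes (en-send c m)
  enabled? x (recv c m) with lookup x c in eq
  ... | [] = no λ { (en-recv _ _ w e) → case trans (sym eq) e of λ () }
  ... | a ∷ w with a ≟ m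
  ...   | yes refl = yes (en-recv c m w eq)
  ...   | no a≢m = no λ { (en-recv _ _ w' e) → a≢m (head-≡ (trans (sym eq) e)) }
    where
    head-≡ : ∀ {a b : Fin nM} {u v} → a ∷ u ≡ b ∷ v → a ≡ b
    head-≡ refl = refl

  OfMove : Set
  OfMove = Op nC nM → Fin nS → Regular

  someMove : OfMove → Fin nS → List Transition → Regular
  someMove G s [] = []
  someMove G s ((s₀ , op , s') ∷ ts) with s₀ ≟ s
  ... | yes _ = G op s' ++ someMove G s ts
  ... | no _  = someMove G s ts

  someMove⁺ : ∀ G s ts op s' x → (s , op , s') ∈ ts → ⟦ G op s' ⟧C x → ⟦ someMove G s ts ⟧C x
  someMove⁺ G s ((s₀ , _) ∷ ts) op s' x (here refl) h with s ≟ s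
  ... | yes _ = ++⁺ˡ h
  ... | no s≢s = ⊥-elim (s≢s refl)
  someMove⁺ G s ((s₀ , op₀ , s₀') ∷ ts) op s' x (there t) h with s₀ ≟ s
  ... | yes _ = ++⁺ʳ (G op₀ s₀') (someMove⁺ G s ts op s' x t h)
  ... | no _  = someMove⁺ G s ts op s' x t h

  someMove⁻ : ∀ G s ts x → ⟦ someMove G s ts ⟧C x →
              Σ (Op nC nM) λ op → Σ (Fin nS) λ s' → (s , op , s') ∈ ts × ⟦ G op s' ⟧C x
  someMove⁻ G s ((s₀ , op₀ , s₀') ∷ ts) x h with s₀ ≟ s
  ... | no _ = let (op , s' , t , g) = someMove⁻ G s ts x h in op , s' , there t , g
  ... | yes refl with ++⁻ (G op₀ s₀') h
  ...   | inj₁ g = op₀ , s₀' , here refl , g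
  ...   | inj₂ g = let (op , s' , t , g') = someMove⁻ G s ts x g in op , s' , there t , g'

  everyMove : OfMove → Fin nS → List Transition → Regular
  everyMove G s [] = everything
  everyMove G s ((s₀ , op , s') ∷ ts) with s₀ ≟ s
  ... | yes _ = G op s' ∩ everyMove G s ts
  ... | no _  = everyMove G s ts

  everyMove⁺ : ∀ G s ts x → (∀ op s' → (s , op , s') ∈ ts → ⟦ G op s' ⟧C x) → ⟦ everyMove G s ts ⟧C x
  everyMove⁺ G s [] x h = here (∈everywhere x)
  everyMove⁺ G s ((s₀ , op₀ , s₀') ∷ ts) x h with s₀ ≟ s
  ... | yes refl = ∩⁺ (G op₀ s₀') (everyMove G s ts) x (h op₀ s₀' (here refl))
                      (everyMove⁺ G s ts x λ op s' t → h op s' (there t))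
  ... | no _ = everyMove⁺ G s ts x λ op s' t → h op s' (there t)

  everyMove⁻ : ∀ G s ts x → ⟦ everyMove G s ts ⟧C x → ∀ op s' → (s , op , s') ∈ ts → ⟦ G op s' ⟧C x
  everyMove⁻ G s ((s₀ , op₀ , s₀') ∷ ts) x h op s' (here refl) with s ≟ s
  ... | yes _ = proj₁ (∩⁻ (G op₀ s₀') (everyMove G s ts) x h)
  ... | no s≢s = ⊥-elim (s≢s refl)
  everyMove⁻ G s ((s₀ , op₀ , s₀') ∷ ts) x h op s' (there t) with s₀ ≟ s
  ... | yes _ = everyMove⁻ G s ts x (proj₂ (∩⁻ (G op₀ s₀') (everyMove G s ts) x h)) op s' t
  ... | no _  = everyMove⁻ G s ts x h op s' t

  someEnabled? : ∀ x s (ts : List Transition) →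
                 Dec (Σ (Op nC nM) λ op → Σ (Fin nS) λ s' → (s , op , s') ∈ ts × Enabled L x op)
  someEnabled? x s [] = no λ ()
  someEnabled? x s ((s₀ , op₀ , s₀') ∷ ts) with s₀ ≟ s | enabled? x op₀ | someEnabled? x s ts
  ... | yes refl | yes en | _ = yes (op₀ , s₀' , here refl , en)
  ... | _ | _ | yes (op , s' , t , en) = yes (op , s' , there t , en)
  ... | yes refl | no ¬en | no none =
        no λ { (_ , _ , here refl , en) → ¬en en ; (op , s' , there t , en) → none (op , s' , t , en) }
  ... | no s₀≢s | _ | no none =
        no λ { (_ , _ , here refl , _) → s₀≢s refl ; (op , s' , there t , en) → none (op , s' , t , en) }


module Saturation (L : SGLCS) (p : Fin 2) (T : RegConfig L) where
  open SGLCS L renaming (trans to transitions)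
  open RegularContents {nC} {nM}
  open Moves L
  open import Data.Fin using (zero; suc; _≟_)
  open import Data.Fin.Properties using (any?)
  open import Data.List as List using (List; []; _∷_; _++_)
  open import Data.List.Membership.Propositional using (_∈_)
  open import Data.List.Relation.Binary.Sublist.Propositional using (_⊆_; ⊆-trans)
  open import Data.List.Relation.Unary.Any using (here; there)
  open import Data.List.Relation.Unary.Any.Properties using (++⁺ˡ; ++⁺ʳ; ++⁻)
  open import Data.Vec using (lookup)
  open import Data.Product using (∃; _×_; proj₁; proj₂)
  open import Data.Sum using (inj₁; inj₂)
  open import Data.Empty using (⊥-elim)
  open import Relation.Binary.PropositionalEquality
  open import Relation.Nullary using (Dec; yes; no; ¬_)
  open import Function.Bundles using (mk⇔)

  Forced : Config L → Set
  Forced = Force L p (⟦_⟧ {L} T)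

  _⪯_ : Channels → Channels → Set
  x' ⪯ x = ∀ c → lookup x' c ⊆ lookup x c

  -- The stuck move
  -- (no transition enabled) keeps the contents.
  -- At p's states: some transition leads into Z, or p is stuck inside Z.
  MinePre : (Fin nS → Regular) → Fin nS → Regular
  MinePre Z s = someMove (λ op s' → pre op (Z s')) s transitions
             ++ (everyMove (λ op _ → disabledR op) s transitions ∩ Z s)

  -- At opponent states: every enabled transition leads into Z, and if none
  -- is enabled the stuck move stays inside Z.
  TheirPre : (Fin nS → Regular) → Fin nS → Regular
  TheirPre Z s = everyMove (λ op s' → disabledR op ++ pre op (Z s')) s transitions
               ∩ (someMove (λ op _ → enabledR op) s transitions ++ Z s)

  PlayerPre : (Fin nS → Regular) → Fin nS → Regular
  PlayerPre Z s with owner s ≟ p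
  ... | yes _ = MinePre Z s
  ... | no _  = TheirPre Z s

  module PreSound (Z : Fin nS → Regular) (Z-forced : ∀ s x → ⟦ Z s ⟧C x → Forced (s , x , zero)) where

    mine-sound : ∀ s x → owner s ≡ p → ⟦ MinePre Z s ⟧C x → Forced (s , x , suc zero)
    mine-sound s x own h with ++⁻ (someMove (λ op s' → pre op (Z s')) s transitions) h
    ... | inj₁ moves = let (op , s' , t , y∈) = someMove⁻ _ s transitions x moves
                           (y , eff , z) = pre⁻ op (Z s') x y∈
                       in mine own (effect-step t eff) (Z-forced s' y z)
    ... | inj₂ stuck = let (disabled , z) = ∩⁻ (everyMove (λ op _ → disabledR op) s transitions) (Z s) x stuck
                           none : NoneApplies L s x
                           none {op} {s'} t = disabledR⁻ x op (everyMove⁻ _ s transitions x disabled op s' t)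
                       in mine own (step-stuck none) (Z-forced s x z)

    theirs-sound : ∀ s x → owner s ≢ p → ⟦ TheirPre Z s ⟧C x → Forced (s , x , suc zero)
    theirs-sound s x ¬own h = theirs ¬own every-step
      where
      parts = ∩⁻ (everyMove (λ op s' → disabledR op ++ pre op (Z s')) s transitions)
                 (someMove (λ op _ → enabledR op) s transitions ++ Z s) x h

      by-effect : ∀ {op s' y} → (s , op , s') ∈ transitions → Effect op x y → Forced (s' , y , zero)
      by-effect {op} {s'} t eff with ++⁻ (disabledR op) (everyMove⁻ _ s transitions x (proj₁ parts) op s' t)
      ... | inj₁ disabled = ⊥-elim (disabledR⁻ x op disabled (effect-enabled eff))
      ... | inj₂ y∈ with pre⁻ op (Z s') x y∈
      ...   | y , eff' , z rewrite effect-functional eff eff' = Z-forced s' y z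

      every-step : ∀ c' → Step L (s , x , suc zero) c' → Forced c'
      every-step _ (step-nop t)      = by-effect t nop
      every-step _ (step-send t)     = by-effect t send
      every-step _ (step-recv t e)   = by-effect t (recv e)
      every-step _ (step-stuck none) with ++⁻ (someMove (λ op _ → enabledR op) s transitions) (proj₂ parts)
      ... | inj₁ some = let (op , s' , t , en) = someMove⁻ _ s transitions x some
                        in ⊥-elim (none t (enabledR⁻ x op en))
      ... | inj₂ z = Z-forced s x z

    playerPre-sound : ∀ s x → ⟦ PlayerPre Z s ⟧C x → Forced (s , x , suc zero)
    playerPre-sound s x h with owner s ≟ p
    ... | yes own  = mine-sound s x own h
    ... | no ¬own = theirs-sound s x ¬own h

  module PreComplete (Z : Fin nS → Regular) where

    ToZ : Fin nS → Channels → Set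
    ToZ s x = ∀ s' y → Step L (s , x , suc zero) (s' , y , zero) → ⟦ Z s' ⟧C y

    mine-complete : ∀ s x s' y → Step L (s , x , suc zero) (s' , y , zero) → ⟦ Z s' ⟧C y → ⟦ MinePre Z s ⟧C x
    mine-complete s x s' y (step-nop t)     z = ++⁺ˡ (someMove⁺ _ s transitions _ s' x t (pre⁺ nop (Z s') x y nop z))
    mine-complete s x s' y (step-send t)    z = ++⁺ˡ (someMove⁺ _ s transitions _ s' x t (pre⁺ _ (Z s') x y send z))
    mine-complete s x s' y (step-recv t e)  z = ++⁺ˡ (someMove⁺ _ s transitions _ s' x t (pre⁺ _ (Z s') x y (recv e) z))
    mine-complete s x s' y (step-stuck none) z =
      ++⁺ʳ (someMove (λ op s' → pre op (Z s')) s transitions)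
        (∩⁺ (everyMove (λ op _ → disabledR op) s transitions) (Z s) x
          (everyMove⁺ _ s transitions x λ op _ t → disabledR⁺ x op (none t)) z)

    theirs-complete : ∀ s x → ToZ s x → ⟦ TheirPre Z s ⟧C x
    theirs-complete s x to-z =
      ∩⁺ (everyMove (λ op s' → disabledR op ++ pre op (Z s')) s transitions)
         (someMove (λ op _ → enabledR op) s transitions ++ Z s) x
         (everyMove⁺ _ s transitions x each-move) some-move-or-stuck
      where
      each-move : ∀ op s' → (s , op , s') ∈ transitions → ⟦ disabledR op ++ pre op (Z s') ⟧C x
      each-move op s' t with enabled? x op
      ... | no ¬en = ++⁺ˡ (disabledR⁺ x op ¬en)
      ... | yes en = let (y , eff) = enabled-effect en
                     in ++⁺ʳ (disabledR op) (pre⁺ op (Z s') x y eff (to-z s' y (effect-step t eff)))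

      some-move-or-stuck : ⟦ someMove (λ op _ → enabledR op) s transitions ++ Z s ⟧C x
      some-move-or-stuck with someEnabled? x s transitions
      ... | yes (op , s' , t , en) = ++⁺ˡ (someMove⁺ _ s transitions op s' x t (enabledR⁺ x op en))
      ... | no none = ++⁺ʳ (someMove (λ op _ → enabledR op) s transitions)
                        (to-z s x (step-stuck λ {op} {s'} t en → none (op , s' , t , en)))

  -- A basis: finitely many contents b at states s with (s, b, 1) forced.
  -- Its upward closure yields forced random configurations (by losses).
  Basis : Set
  Basis = List (Fin nS × Channels)

  Above : Basis → Fin nS → Regular
  Above [] s = []
  Above ((s₀ , b) ∷ B) s with s₀ ≟ s
  ... | yes _ = above□ b ∷ Above B s
  ... | no _  = Above B s

  Above⁺ : ∀ B s b x → (s , b) ∈ B → b ⪯ x → ⟦ Above B s ⟧C x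
  Above⁺ ((s₀ , _) ∷ B) s b x (here refl) b⪯x with s ≟ s
  ... | yes _ = here (above□⁺ b x b⪯x)
  ... | no s≢s = ⊥-elim (s≢s refl)
  Above⁺ ((s₀ , _) ∷ B) s b x (there i) b⪯x with s₀ ≟ s
  ... | yes _ = there (Above⁺ B s b x i b⪯x)
  ... | no _  = Above⁺ B s b x i b⪯x

  Above⁻ : ∀ B s x → ⟦ Above B s ⟧C x → Σ Channels λ b → (s , b) ∈ B × b ⪯ x
  Above⁻ ((s₀ , b₀) ∷ B) s x h with s₀ ≟ s
  Above⁻ ((s₀ , b₀) ∷ B) s x (here m)  | yes refl = b₀ , here refl , above□⁻ b₀ x m
  Above⁻ ((s₀ , b₀) ∷ B) s x (there h) | yes refl = let (b , i , b⪯x) = Above⁻ B s x h in b , there i , b⪯x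
  Above⁻ ((s₀ , b₀) ∷ B) s x h         | no _     = let (b , i , b⪯x) = Above⁻ B s x h in b , there i , b⪯x

  RandomPart : Basis → Fin nS → Regular
  RandomPart B s = T s zero ++ Above B s

  PlayerPart : Basis → Fin nS → Regular
  PlayerPart B s = T s (suc zero) ++ PlayerPre (RandomPart B) s

  Candidate : Basis → RegConfig L
  Candidate B s zero       = RandomPart B s
  Candidate B s (suc zero) = PlayerPart B s

  BasisForced : Basis → Set
  BasisForced B = ∀ {s b} → (s , b) ∈ B → Forced (s , b , suc zero)

  randomPart-sound : ∀ B → BasisForced B → ∀ s x → ⟦ RandomPart B s ⟧C x → Forced (s , x , zero)
  randomPart-sound B forced s x h with ++⁻ (T s zero) h
  ... | inj₁ t = base t
  ... | inj₂ a = let (b , i , b⪯x) = Above⁻ B s x a in random (step-lose b⪯x) (forced i)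

  candidate-sound : ∀ B → BasisForced B → ∀ c → ⟦_⟧ {L} (Candidate B) c → Forced c
  candidate-sound B forced (s , x , zero)     h = randomPart-sound B forced s x h
  candidate-sound B forced (s , x , suc zero) h with ++⁻ (T s (suc zero)) h
  ... | inj₁ t = base t
  ... | inj₂ q = PreSound.playerPre-sound (RandomPart B) (randomPart-sound B forced) s x q

  Saturated : Basis → Set
  Saturated B = ∀ s x → ⟦ PlayerPart B s ⟧C x → ⟦ Above B s ⟧C x

  candidate-complete : ∀ B → Saturated B → ∀ {c} → Forced c → ⟦_⟧ {L} (Candidate B) c
  candidate-complete B sat (base {s , x , zero} t)     = ++⁺ˡ t
  candidate-complete B sat (base {s , x , suc zero} t) = ++⁺ˡ t
  candidate-complete B sat (random {s} {x} (step-lose {x' = x'} x'⪯x) f)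
    with Above⁻ B s x' (sat s x' (candidate-complete B sat f))
  ... | b , i , b⪯x' = ++⁺ʳ (T s zero) (Above⁺ B s b x i (λ c → ⊆-trans (b⪯x' c) (x'⪯x c)))
  candidate-complete B sat (mine {s} {x} {s' , y , zero} own st f) with owner s ≟ p
  ... | yes _ = ++⁺ʳ (T s (suc zero)) (PreComplete.mine-complete (RandomPart B) s x s' y st
                                         (candidate-complete B sat f))
  ... | no ¬own = ⊥-elim (¬own own)
  candidate-complete B sat (theirs {s} {x} ¬own h) with owner s ≟ p
  ... | yes own = ⊥-elim (¬own own)
  ... | no _ = ++⁺ʳ (T s (suc zero)) (PreComplete.theirs-complete (RandomPart B) s x
                                        (λ s' y st → candidate-complete B sat (h _ st)))

  NewElement : Basis → Set
  NewElement B = ∃ λ s → Σ Channels λ x → ⟦ PlayerPart B s ⟧C x × ¬ ⟦ Above B s ⟧C x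

  newElement? : ∀ B → Dec (NewElement B)
  newElement? B with any? (λ s → nonemptyR? (PlayerPart B s ∩ complementR (Above B s)))
  ... | yes (s , x , h) = let (player , outside) = ∩⁻ (PlayerPart B s) (complementR (Above B s)) x h
                          in yes (s , x , player , complementR⁻ (Above B s) x outside)
  ... | no none = no λ (s , x , player , ¬above) →
          none (s , x , ∩⁺ (PlayerPart B s) (complementR (Above B s)) x player (complementR⁺ (Above B s) x ¬above))

  no-new-saturated : ∀ B → ¬ NewElement B → Saturated B
  no-new-saturated B ¬new s x player with ∈? x (Above B s)
  ... | yes above = above
  ... | no ¬above = ⊥-elim (¬new (s , x , player , ¬above))

  -- Termination via Higman's lemma on the encoded basis: a new element is
  -- never above an old one, so the encoded basis stays a bad sequence.
  open Encoding nS nM using (K; encode; decode)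
  module H = Higman {K}

  encodeBasis : Basis → List (List (Fin K))
  encodeBasis = List.map encode

  embedded-below : ∀ B s x → H.Embeds (encode (s , x)) (encodeBasis B) → Σ Channels λ b → (s , b) ∈ B × b ⪯ x
  embedded-below ((s₀ , b) ∷ B) s x (H.here sub) with decode s₀ s b x sub
  ... | refl , b⪯x = b , here refl , b⪯x
  embedded-below (_ ∷ B) s x (H.there e) = let (b , i , b⪯x) = embedded-below B s x e in b , there i , b⪯x

  record SaturatedBasis : Set where
    field
      basis     : Basis
      forced    : BasisForced basis
      saturated : Saturated basis

  saturate : ∀ B → H.Bar (encodeBasis B) → ¬ H.Good (encodeBasis B) → BasisForced B → SaturatedBasis
  saturate B bar bad forced with newElement? B
  ... | no ¬new = record { basis = B ; forced = forced ; saturated = no-new-saturated B ¬new }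
  ... | yes (s , x , player , ¬above) with bar
  ...   | H.good g    = ⊥-elim (bad g)
  ...   | H.step next = saturate ((s , x) ∷ B) (next (encode (s , x))) still-bad still-forced
    where
    still-bad : ¬ H.Good (encodeBasis ((s , x) ∷ B))
    still-bad (H.now e)   = let (b , i , b⪯x) = embedded-below B s x e in ¬above (Above⁺ B s b x i b⪯x)
    still-bad (H.later g) = bad g

    still-forced : BasisForced ((s , x) ∷ B)
    still-forced (here refl) = candidate-sound B forced (s , x , suc zero) player
    still-forced (there i)   = forced i

  force-regular : Σ (RegConfig L) λ F → ∀ c → Forced c ⇔ ⟦_⟧ {L} F c
  force-regular = Candidate basis , λ c → mk⇔ (candidate-complete basis saturated) (candidate-sound basis forced c)
    where open SaturatedBasis (saturate [] H.higman (λ ()) (λ ()))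


lemma5p11 : Σ ((L : SGLCS) → Fin 2 → RegConfig L → RegConfig L)
              (λ F → (L : SGLCS) (x : Fin 2) (T : RegConfig L) (c : Config L) →
                Force L x (⟦_⟧ {L} T) c ⇔ ⟦_⟧ {L} (F L x T) c)
lemma5p11 = (λ L x T → proj₁ (force-regular L x T)) , λ L x T → proj₂ (force-regular L x T)
  where
  open Saturation using (force-regular)
  open import Data.Product using (proj₁; proj₂)
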